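{- Let $k\geq s\geq 2$ be natural numbers. Every $k$-surviving Turing degree is also an $s$-surviving Turing degree.
   Context: A tree is a subset of $n^{<\omega}$ (or $\omega^{<\omega}$) closed under initial segments. A $k$-branching tree is a tree in which every node has either exactly $1$ or exactly $k$ immediate successors. A function $f\in (k+1)^\omega$ is $k$-surviving if it is not an infinite path through any computable $k$-branching subtree of $(k+1)^{<\omega}$. A Turing degree is $k$-surviving if it computes a $k$-surviving function. -}

module Defs where

open import Data.Nat using (ℕ; zero; suc; _+_; _*_; _^_; _<_)
open import Data.Fin using (Fin; toℕ)
open import Data.Vec using (Vec; []; _∷_)
open import Data.List using (List; []; _∷_; _++_; [_]; map; allFin)
open import Data.Nat.ListAction using (sum)
open import Data.Bool using (Bool; true; false; if_then_else_)
open import Data.Product using (Σ; ∃; _×_)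
open import Data.Sum using (_⊎_)
open import Relation.Binary.PropositionalEquality using (_≡_)
open import Relation.Nullary using (¬_)

-- Oracle partial recursive functions (Kleene's μ-recursive functions
-- with an extra unary oracle basic function).

data Code : ℕ → Set where
  czero  : ∀ {n} → Code n
  csucc  : Code 1
  cproj  : ∀ {n} → Fin n → Code n
  corac  : Code 1
  ccomp  : ∀ {m n} → Code m → Vec (Code n) m → Code n
  cprec  : ∀ {n} → Code n → Code (suc (suc n)) → Code (suc n)
  cmu    : ∀ {n} → Code (suc n) → Code n

lookupV : ∀ {A : Set} {n} → Vec A n → Fin n → A
lookupV (x ∷ xs) Fin.zero    = x
lookupV (x ∷ xs) (Fin.suc i) = lookupV xs i

mutual
  data Eval (O : ℕ → ℕ) : ∀ {n} → Code n → Vec ℕ n → ℕ → Set where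
    ev-zero : ∀ {n} {xs : Vec ℕ n} → Eval O czero xs 0
    ev-succ : ∀ {x} → Eval O csucc (x ∷ []) (suc x)
    ev-proj : ∀ {n} {i : Fin n} {xs} → Eval O (cproj i) xs (lookupV xs i)
    ev-orac : ∀ {x} → Eval O corac (x ∷ []) (O x)
    ev-comp : ∀ {m n} {f : Code m} {gs : Vec (Code n) m} {xs ys r} →
              EvalVec O gs xs ys → Eval O f ys r → Eval O (ccomp f gs) xs r
    ev-prec0 : ∀ {n} {g : Code n} {h} {xs r} →
               Eval O g xs r → Eval O (cprec g h) (0 ∷ xs) r
    ev-precS : ∀ {n} {g : Code n} {h} {y xs r r′} →
               Eval O (cprec g h) (y ∷ xs) r →
               Eval O h (y ∷ r ∷ xs) r′ →
               Eval O (cprec g h) (suc y ∷ xs) r′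
    ev-mu : ∀ {n} {e : Code (suc n)} {xs x} →
            Eval O e (x ∷ xs) 0 →
            (∀ y → y < x → Σ ℕ λ r → Eval O e (y ∷ xs) (suc r)) →
            Eval O (cmu e) xs x

  data EvalVec (O : ℕ → ℕ) {n} : ∀ {m} → Vec (Code n) m → Vec ℕ n → Vec ℕ m → Set where
    evv-nil  : ∀ {xs} → EvalVec O [] xs []
    evv-cons : ∀ {m} {g} {gs : Vec (Code n) m} {xs y ys} →
               Eval O g xs y → EvalVec O gs xs ys → EvalVec O (g ∷ gs) xs (y ∷ ys)

ComputesFrom : (ℕ → ℕ) → (ℕ → ℕ) → Set
ComputesFrom O h = Σ (Code 1) λ e → ∀ n → Eval O e (n ∷ []) (h n)

Computable : (ℕ → ℕ) → Set
Computable h = ComputesFrom (λ _ → 0) h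

-- Finite strings over n = {0,…,n-1} (head = first entry) and their codes.

pair : ℕ → ℕ → ℕ
pair a b = 2 ^ a * (2 * b + 1)

encode : ∀ {n} → List (Fin n) → ℕ
encode []      = 0
encode (x ∷ σ) = pair (toℕ x) (encode σ)

_⪯_ : ∀ {n} → List (Fin n) → List (Fin n) → Set
σ ⪯ τ = Σ _ λ ρ → σ ++ ρ ≡ τ

IsTree : ∀ {n} → (List (Fin n) → Bool) → Set
IsTree T = ∀ σ τ → σ ⪯ τ → T τ ≡ true → T σ ≡ true

succCount : ∀ {n} → (List (Fin n) → Bool) → List (Fin n) → ℕ
succCount {n} T σ = sum (map (λ i → if T (σ ++ [ i ]) then 1 else 0) (allFin n))

IsBranching : ∀ {n} → ℕ → (List (Fin n) → Bool) → Set
IsBranching k T = ∀ σ → T σ ≡ true → (succCount T σ ≡ 1 ⊎ succCount T σ ≡ k)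

ComputableTree : ∀ {n} → (List (Fin n) → Bool) → Set
ComputableTree T = Σ (ℕ → ℕ) λ χ →
  Computable χ × (∀ σ → χ (encode σ) ≡ (if T σ then 1 else 0))

restrict : ∀ {n} → (ℕ → Fin n) → ℕ → List (Fin n)
restrict f zero    = []
restrict f (suc m) = restrict f m ++ [ f m ]

IsPath : ∀ {n} → (List (Fin n) → Bool) → (ℕ → Fin n) → Set
IsPath T f = ∀ m → T (restrict f m) ≡ true

Surviving : (k : ℕ) → (ℕ → Fin (suc k)) → Set
Surviving k f = ∀ (T : List (Fin (suc k)) → Bool) →
  IsTree T → IsBranching k T → ComputableTree T → ¬ IsPath T f

-- The degree of the oracle g is k-surviving: g computes a k-surviving function.
-- (Turing degrees are represented by any member g : ℕ → ℕ; this notion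
-- is invariant under Turing equivalence.)
SurvivingDegree : ℕ → (ℕ → ℕ) → Set
SurvivingDegree k g = Σ (ℕ → Fin (suc k)) λ f →
  ComputesFrom g (λ n → toℕ (f n)) × Surviving k f

module Submission where

open import Defs
open import Data.Nat using (ℕ; zero; suc; pred; _+_; _*_; _∸_; _^_; _≤_; _<_; z≤n; s≤s; _<ᵇ_; _≡ᵇ_; NonZero; >-nonZero)
open import Data.Nat.Properties
open import Data.Nat.Tactic.RingSolver using (solve-∀)
open import Data.Nat.ListAction using (sum)
open import Data.Fin using (Fin; toℕ) renaming (zero to fz; suc to fs)
open import Data.Vec using (Vec; []; _∷_; head; tail) renaming (tabulate to tabulateᵥ)
open import Data.List using (List; []; _∷_; _++_; [_]; length; map; tabulate)
open import Data.List.Properties using (++-assoc; ++-identityʳ; map-++; map-tabulate)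
open import Data.Bool using (Bool; true; false; if_then_else_; not; _∧_; _∨_)
open import Data.Bool.Properties using (if-float; ∨-identityʳ; ∧-zeroʳ)
open import Data.Product using (Σ; _,_; proj₁; proj₂; _×_)
open import Data.Sum using (_⊎_; inj₁; inj₂) renaming ([_,_] to either)
open import Data.Empty using (⊥-elim)
open import Relation.Nullary using (¬_; yes; no)
open import Relation.Binary.PropositionalEquality using (_≡_; refl; sym; trans; cong; cong₂; subst; module ≡-Reasoning)
open import Function using (_∘_; id)

-- Let g compute a k-surviving f : ℕ → {0,…,k}.  Its clamp h = min(f, s) is
-- computable from g, and h is s-surviving: if h were a path through a
-- computable s-branching tree T, the tree Tk constructed below would be a
-- computable k-branching tree with f as a path.  A string σ over {0,…,k}
-- is in Tk according to an automaton that reads σ while tracking its shadow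
-- min(σ, s) in T: a letter j continues the tracking iff min(j, s) is a child
-- of the tracked node, and the children still missing are added as "free"
-- nodes carrying the full k-branching tree on {0,…,k-1} (the padding rule
-- `pad`), so that every node of Tk has exactly 1 or exactly k children.

-- The 0/1 indicator of a boolean; `bit b` is literally `if b then 1 else 0`,
-- the form in which Defs states that a function decides a tree.
bit : Bool → ℕ
bit b = if b then 1 else 0

positive : ℕ → Bool
positive zero    = false
positive (suc _) = true

positive-∸ : ∀ m n → positive (n ∸ m) ≡ (m <ᵇ n)
positive-∸ zero    zero    = refl
positive-∸ zero    (suc n) = refl
positive-∸ (suc m) zero    = refl
positive-∸ (suc m) (suc n) = positive-∸ m n

positive-distance : ∀ m n → not (positive ((m ∸ n) + (n ∸ m))) ≡ (m ≡ᵇ n)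
positive-distance zero    zero    = refl
positive-distance zero    (suc n) = refl
positive-distance (suc m) zero    = refl
positive-distance (suc m) (suc n) = positive-distance m n

sumBelow : ℕ → (ℕ → ℕ) → ℕ
sumBelow zero    F = 0
sumBelow (suc m) F = sumBelow m F + F m

iter : (ℕ → ℕ) → ℕ → ℕ → ℕ
iter F zero    x = x
iter F (suc n) x = F (iter F n x)

iter-suc : ∀ F n x → iter F (suc n) x ≡ iter F n (F x)
iter-suc F zero    x = refl
iter-suc F (suc n) x = cong F (iter-suc F n x)

iter-fixed : ∀ F n x → F x ≡ x → iter F n x ≡ x
iter-fixed F zero    x Fx≡x = refl
iter-fixed F (suc n) x Fx≡x = trans (cong F (iter-fixed F n x Fx≡x)) Fx≡x

positive-bit : ∀ b → positive (bit b) ≡ b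
positive-bit true  = refl
positive-bit false = refl

≡ᵇ-refl : ∀ n → (n ≡ᵇ n) ≡ true
≡ᵇ-refl zero    = refl
≡ᵇ-refl (suc n) = ≡ᵇ-refl n

≢⇒≡ᵇ-false : ∀ m n → ¬ m ≡ n → (m ≡ᵇ n) ≡ false
≢⇒≡ᵇ-false zero    zero    m≢n = ⊥-elim (m≢n refl)
≢⇒≡ᵇ-false zero    (suc n) m≢n = refl
≢⇒≡ᵇ-false (suc m) zero    m≢n = refl
≢⇒≡ᵇ-false (suc m) (suc n) m≢n = ≢⇒≡ᵇ-false m n (m≢n ∘ cong suc)

<ᵇ-true : ∀ {j n} → j < n → (j <ᵇ n) ≡ true
<ᵇ-true {zero}  {suc n} _         = refl
<ᵇ-true {suc j} {suc n} (s≤s j<n) = <ᵇ-true j<n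

<ᵇ-false : ∀ {j n} → n ≤ j → (j <ᵇ n) ≡ false
<ᵇ-false {j}     {zero}  _         = refl
<ᵇ-false {suc j} {suc n} (s≤s n≤j) = <ᵇ-false n≤j

<ᵇ-≢ : ∀ {j i} → j ≤ i → (j <ᵇ i) ≡ not (j ≡ᵇ i)
<ᵇ-≢ {zero}  {zero}  _         = refl
<ᵇ-≢ {zero}  {suc i} _         = refl
<ᵇ-≢ {suc j} {suc i} (s≤s j≤i) = <ᵇ-≢ j≤i

true≢false : ¬ true ≡ false
true≢false ()


count : ℕ → (ℕ → Bool) → ℕ
count zero    P = 0
count (suc n) P = bit (P 0) + count n (P ∘ suc)

count-cong : ∀ n {P Q} → (∀ j → j < n → P j ≡ Q j) → count n P ≡ count n Q
count-cong zero    P≡Q = refl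
count-cong (suc n) P≡Q = cong₂ _+_ (cong bit (P≡Q 0 (s≤s z≤n))) (count-cong n λ j j<n → P≡Q (suc j) (s≤s j<n))

count-split : ∀ a b P → count (a + b) P ≡ count a P + count b (λ j → P (a + j))
count-split zero    b P = refl
count-split (suc a) b P = trans (cong (bit (P 0) +_) (count-split a b (P ∘ suc))) (sym (+-assoc (bit (P 0)) _ _))

count-last : ∀ n P → count (suc n) P ≡ count n P + bit (P n)
count-last n P = trans (cong (λ m → count m P) (+-comm 1 n)) (trans (count-split n 1 P) (cong (count n P +_) (trans (+-identityʳ _) (cong (bit ∘ P) (+-identityʳ n)))))

count-const : ∀ n b → count n (λ _ → b) ≡ n * bit b
count-const zero    b = refl
count-const (suc n) b = cong (bit b +_) (count-const n b)

count≤ : ∀ n P → count n P ≤ n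
count≤ zero    P = z≤n
count≤ (suc n) P with P 0
... | true  = s≤s (count≤ n (P ∘ suc))
... | false = m≤n⇒m≤1+n (count≤ n (P ∘ suc))

count-full : ∀ n P → count n P ≡ n → ∀ j → j < n → P j ≡ true
count-full (suc n) P full j j<n with P 0 in P0
count-full (suc n) P full zero    _         | true  = P0
count-full (suc n) P full (suc j) (s≤s j<n) | true  = count-full n (P ∘ suc) (suc-injective full) j j<n
count-full (suc n) P full j       _         | false = ⊥-elim (<-irrefl full (s≤s (count≤ n (P ∘ suc))))

count-empty : ∀ n P → count n P ≡ 0 → ∀ j → j < n → P j ≡ false
count-empty (suc n) P empty j j<n with P 0 in P0
count-empty (suc n) P empty zero    _         | false = P0
count-empty (suc n) P empty (suc j) (s≤s j<n) | false = count-empty n (P ∘ suc) empty j j<n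

count-below : ∀ n b → b ≤ n → count n (_<ᵇ b) ≡ b
count-below n       zero    _         = trans (count-const n false) (*-zeroʳ n)
count-below (suc n) (suc b) (s≤s b≤n) = cong suc (count-below n b b≤n)

count-except : ∀ n i → i < n → count n (λ j → not (j ≡ᵇ i)) ≡ pred n
count-except (suc n) zero    _         = trans (count-const n true) (*-identityʳ n)
count-except (suc (suc n)) (suc i) (s≤s i<n) = cong suc (count-except (suc n) i i<n)

sum-zero : ∀ F m → (∀ i → i < m → F i ≡ 0) → sumBelow m F ≡ 0
sum-zero F zero    F≡0 = refl
sum-zero F (suc m) F≡0 =
  cong₂ _+_ (sum-zero F m λ i i<m → F≡0 i (m<n⇒m<1+n i<m)) (F≡0 m ≤-refl)

sum-single : ∀ F m i → i < m → (∀ j → j < m → ¬ j ≡ i → F j ≡ 0) → sumBelow m F ≡ F i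
sum-single F (suc m) i i<1+m F≡0 with m ≟ i
... | yes refl = cong (_+ F m) (sum-zero F m λ j j<m → F≡0 j (m<n⇒m<1+n j<m) (<⇒≢ j<m))
... | no m≢i   = trans (cong₂ _+_ (sum-single F m i i<m λ j j<m → F≡0 j (m<n⇒m<1+n j<m))
                                  (F≡0 m ≤-refl m≢i))
                       (+-identityʳ (F i))
  where
  i<m : i < m
  i<m = ≤∧≢⇒< (≤-pred i<1+m) (m≢i ∘ sym)

-- The pairing  pair a b = 2ᵃ(2b+1)  is injective (2-adic valuation and odd part).
pair-zero : ∀ b → pair 0 b ≡ suc (2 * b)
pair-zero b = trans (+-identityʳ (2 * b + 1)) (+-comm (2 * b) 1)

pair-suc : ∀ a b → pair (suc a) b ≡ 2 * pair a b
pair-suc a b = *-assoc 2 (2 ^ a) (2 * b + 1)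

pair-injective : ∀ a b a′ b′ → pair a b ≡ pair a′ b′ → a ≡ a′ × b ≡ b′
pair-injective zero b zero b′ eq =
  refl , *-cancelˡ-≡ b b′ 2 (suc-injective (trans (sym (pair-zero b)) (trans eq (pair-zero b′))))
pair-injective zero b (suc a′) b′ eq =
  ⊥-elim (even≢odd (pair a′ b′) b (sym (trans (sym (pair-zero b)) (trans eq (pair-suc a′ b′)))))
pair-injective (suc a) b zero b′ eq =
  ⊥-elim (even≢odd (pair a b) b′ (trans (sym (pair-suc a b)) (trans eq (pair-zero b′))))
pair-injective (suc a) b (suc a′) b′ eq
  with pair-injective a b a′ b′ (*-cancelˡ-≡ _ _ 2 (trans (sym (pair-suc a b)) (trans eq (pair-suc a′ b′))))
... | refl , refl = refl , refl

fst<pair : ∀ a b → a < pair a b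
fst<pair zero    b = subst (0 <_) (sym (pair-zero b)) (s≤s z≤n)
fst<pair (suc a) b = subst (suc a <_) (sym (pair-suc a b)) (≤-trans (s≤s a<p) (double (≤-trans (s≤s z≤n) a<p)))
  where
  a<p : a < pair a b
  a<p = fst<pair a b
  double : ∀ {m} → 0 < m → suc m ≤ 2 * m
  double {m} 0<m = subst (_≤ 2 * m) (+-comm m 1) (+-monoʳ-≤ m (≤-trans 0<m (m≤m+n m 0)))

snd<pair : ∀ a b → b < pair a b
snd<pair zero    b = subst (b <_) (sym (pair-zero b)) (s≤s (m≤m+n b (b + 0)))
snd<pair (suc a) b = subst (b <_) (sym (pair-suc a b)) (≤-trans (snd<pair a b) (m≤m+n (pair a b) _))

-- Inverting the pairing by bounded search: unpair sel (pair a b) = sel a b.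
-- (Opaque: only unpair-pair and the computability of unpair need its
-- definition, and normalising it is expensive.)
opaque
 unpair : (ℕ → ℕ → ℕ) → ℕ → ℕ
 unpair sel x = sumBelow (suc x) λ a → sumBelow (suc x) λ b → if pair a b ≡ᵇ x then sel a b else 0

 unpair-pair : ∀ sel a b → unpair sel (pair a b) ≡ sel a b
 unpair-pair sel a b = trans (sum-single _ (suc x) a (s≤s (<⇒≤ (fst<pair a b))) otherRows) rowA
   where
   x : ℕ
   x = pair a b
   -- only the pair (a , b) passes the test  pair a′ b′ ≡ᵇ x
   test-fails : ∀ a′ b′ → ¬ (a′ ≡ a × b′ ≡ b) → (if pair a′ b′ ≡ᵇ x then sel a′ b′ else 0) ≡ 0
   test-fails a′ b′ ne rewrite ≢⇒≡ᵇ-false (pair a′ b′) x (ne ∘ pair-injective a′ b′ a b) = refl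
   otherRows : ∀ a′ → a′ < suc x → ¬ a′ ≡ a → sumBelow (suc x) (λ b′ → if pair a′ b′ ≡ᵇ x then sel a′ b′ else 0) ≡ 0
   otherRows a′ _ a′≢a = sum-zero _ (suc x) λ b′ _ → test-fails a′ b′ (a′≢a ∘ proj₁)
   rowA : sumBelow (suc x) (λ b′ → if pair a b′ ≡ᵇ x then sel a b′ else 0) ≡ sel a b
   rowA = trans (sum-single _ (suc x) b (s≤s (<⇒≤ (snd<pair a b))) λ b′ _ b′≢b → test-fails a b′ (b′≢b ∘ proj₂))
                (cong (λ t → if t then sel a b else 0) (≡ᵇ-refl x))

first second : ℕ → ℕ
first  = unpair (λ a b → a)
second = unpair (λ a b → b)

first-pair : ∀ a b → first (pair a b) ≡ a
first-pair = unpair-pair (λ a b → a)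

second-pair : ∀ a b → second (pair a b) ≡ b
second-pair = unpair-pair (λ a b → b)

pair-positive : ∀ a b → positive (pair a b) ≡ true
pair-positive a b with pair a b | fst<pair a b
... | suc _ | _ = refl

-- Appending a letter q to τ adds  2 ^ (offset τ + q)  to the code of τ.
offset : ∀ {n} → List (Fin n) → ℕ
offset []      = 0
offset (x ∷ τ) = toℕ x + suc (offset τ)

offset-snoc : ∀ {n} (τ : List (Fin n)) q → offset (τ ++ [ q ]) ≡ suc (offset τ + toℕ q)
offset-snoc []      q = +-comm (toℕ q) 1
offset-snoc (x ∷ τ) q = trans (cong (λ o → toℕ x + suc o) (offset-snoc τ q))
                        (trans (+-suc (toℕ x) (suc (offset τ) + toℕ q)) (cong suc (sym (+-assoc (toℕ x) (suc (offset τ)) (toℕ q)))))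

encode-snoc : ∀ {n} (τ : List (Fin n)) q → encode (τ ++ [ q ]) ≡ encode τ + 2 ^ (offset τ + toℕ q)
encode-snoc []      q = *-identityʳ (2 ^ toℕ q)
encode-snoc (x ∷ τ) q = begin
  2 ^ a * (2 * encode (τ ++ [ q ]) + 1)          ≡⟨ cong (λ e → 2 ^ a * (2 * e + 1)) (encode-snoc τ q) ⟩
  2 ^ a * (2 * (encode τ + 2 ^ (o + b)) + 1)     ≡⟨ distribute (2 ^ a) (encode τ) (2 ^ (o + b)) ⟩
  pair a (encode τ) + 2 ^ a * 2 ^ suc (o + b)    ≡⟨ cong (pair a (encode τ) +_) (sym (^-distribˡ-+-* 2 a (suc (o + b)))) ⟩
  pair a (encode τ) + 2 ^ (a + suc (o + b))      ≡⟨ cong (λ e → pair a (encode τ) + 2 ^ e) (sym (+-assoc a (suc o) b)) ⟩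
  pair a (encode τ) + 2 ^ (a + suc o + b)        ∎
  where
  open ≡-Reasoning
  a o b : ℕ
  a = toℕ x
  o = offset τ
  b = toℕ q
  distribute : ∀ w e p → w * (2 * (e + p) + 1) ≡ w * (2 * e + 1) + w * (2 * p)
  distribute = solve-∀

-- A code bounds the length of the string (so  encode σ  steps of the
-- decoding automaton suffice).
length≤encode : ∀ {n} (σ : List (Fin n)) → length σ ≤ encode σ
length≤encode []      = z≤n
length≤encode (x ∷ σ) = ≤-trans (s≤s (length≤encode σ)) (≤-trans suc≤odd (m≤n*m (2 * e + 1) (2 ^ toℕ x) {{2^-nonZero}}))
  where
  e : ℕ
  e = encode σ
  suc≤odd : suc e ≤ 2 * e + 1
  suc≤odd = subst (_≤ 2 * e + 1) (+-comm e 1) (+-monoˡ-≤ 1 (m≤m+n e (e + 0)))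
  2^-nonZero : NonZero (2 ^ toℕ x)
  2^-nonZero = >-nonZero (m^n>0 2 (toℕ x))

module Recursive (O : ℕ → ℕ) where

  Rec : ∀ n → (Vec ℕ n → ℕ) → Set
  Rec n F = Σ (Code n) λ e → ∀ xs → Eval O e xs (F xs)

  RecVec : ∀ n m → (Vec ℕ n → Vec ℕ m) → Set
  RecVec n m G = Σ (Vec (Code n) m) λ es → ∀ xs → EvalVec O es xs (G xs)

  RecPred : ∀ n → (Vec ℕ n → Bool) → Set
  RecPred n B = Rec n (λ xs → bit (B xs))

  extensional : ∀ {n F G} → Rec n F → (∀ xs → F xs ≡ G xs) → Rec n G
  extensional (e , ev) F≡G = e , λ xs → subst (Eval O e xs) (F≡G xs) (ev xs)

  extensionalVec : ∀ {n m F G} → RecVec n m F → (∀ xs → F xs ≡ G xs) → RecVec n m G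
  extensionalVec (es , ev) F≡G = es , λ xs → subst (EvalVec O es xs) (F≡G xs) (ev xs)

  nilR : ∀ {n} → RecVec n 0 (λ _ → [])
  nilR = [] , λ _ → evv-nil

  consR : ∀ {n m F G} → Rec n F → RecVec n m G → RecVec n (suc m) (λ xs → F xs ∷ G xs)
  consR (e , ev) (es , evs) = e ∷ es , λ xs → evv-cons (ev xs) (evs xs)

  compR : ∀ {n m F G} → Rec m F → RecVec n m G → Rec n (λ xs → F (G xs))
  compR (e , ev) (es , evs) = ccomp e es , λ xs → ev-comp (evs xs) (ev _)

  projR : ∀ {n} (i : Fin n) → Rec n (λ xs → lookupV xs i)
  projR i = cproj i , λ _ → ev-proj

  zeroR : ∀ {n} → Rec n (λ _ → 0)
  zeroR = czero , λ _ → ev-zero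

  -- Unary and binary operations that are computable, in a form that
  -- composes directly with computable arguments.
  Op1 : (ℕ → ℕ) → Set
  Op1 f = ∀ {n g} → Rec n g → Rec n (λ xs → f (g xs))

  Op2 : (ℕ → ℕ → ℕ) → Set
  Op2 f = ∀ {n g h} → Rec n g → Rec n h → Rec n (λ xs → f (g xs) (h xs))

  op1 : ∀ {f} → Rec 1 (λ xs → f (lookupV xs fz)) → Op1 f
  op1 rf rg = compR rf (consR rg nilR)

  op2 : ∀ {f} → Rec 2 (λ xs → f (lookupV xs fz) (lookupV xs (fs fz))) → Op2 f
  op2 rf rg rh = compR rf (consR rg (consR rh nilR))

  fromComputes : ∀ {h} → ComputesFrom O h → Op1 h
  fromComputes (e , ev) = op1 (e , λ { (x ∷ []) → ev x })

  toComputes : ∀ {h} → Op1 h → ComputesFrom O h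
  toComputes rh with rh (projR fz)
  ... | e , ev = e , λ x → ev (x ∷ [])

  sucR : Op1 suc
  sucR = op1 (csucc , λ { (x ∷ []) → ev-succ })

  constR : ∀ {n} c → Rec n (λ _ → c)
  constR zero    = zeroR
  constR (suc c) = sucR (constR c)

  primrec : ∀ {n} → (Vec ℕ n → ℕ) → (Vec ℕ (suc (suc n)) → ℕ) → Vec ℕ (suc n) → ℕ
  primrec G H (zero  ∷ xs) = G xs
  primrec G H (suc y ∷ xs) = H (y ∷ primrec G H (y ∷ xs) ∷ xs)

  primrecR : ∀ {n G H} → Rec n G → Rec (suc (suc n)) H → Rec (suc n) (primrec G H)
  primrecR {G = G} {H} (g , evg) (h , evh) = cprec g h , ev
    where
    ev : ∀ xs → Eval O (cprec g h) xs (primrec G H xs)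
    ev (zero  ∷ xs) = ev-prec0 (evg xs)
    ev (suc y ∷ xs) = ev-precS (ev (y ∷ xs)) (evh _)

  renameR : ∀ {m n} (ρ : Fin m → Fin n) → RecVec n m (λ xs → tabulateᵥ (λ i → lookupV xs (ρ i)))
  renameR {zero}  ρ = nilR
  renameR {suc m} ρ = consR (projR (ρ fz)) (renameR (ρ ∘ fs))

  tabulate-lookupV : ∀ {n} (xs : Vec ℕ n) → tabulateᵥ (lookupV xs) ≡ xs
  tabulate-lookupV []       = refl
  tabulate-lookupV (x ∷ xs) = cong (x ∷_) (tabulate-lookupV xs)

  dropSecond : ∀ {n} → Vec ℕ (suc (suc n)) → Vec ℕ (suc n)
  dropSecond (y ∷ _ ∷ xs) = y ∷ xs

  dropSecondR : ∀ {n} → RecVec (suc (suc n)) (suc n) dropSecond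
  dropSecondR = extensionalVec (renameR shift) λ { (y ∷ _ ∷ xs) → cong (y ∷_) (tabulate-lookupV xs) }
    where
    shift : ∀ {n} → Fin (suc n) → Fin (suc (suc n))
    shift fz     = fz
    shift (fs i) = fs (fs i)

  at₀ : ∀ {n} → Vec ℕ (suc n) → ℕ
  at₀ xs = lookupV xs fz

  at₁ : ∀ {n} → Vec ℕ (suc (suc n)) → ℕ
  at₁ xs = lookupV xs (fs fz)

  at₂ : ∀ {n} → Vec ℕ (suc (suc (suc n))) → ℕ
  at₂ xs = lookupV xs (fs (fs fz))

  x₀ : ∀ {n} → Rec (suc n) at₀
  x₀ = projR fz

  x₁ : ∀ {n} → Rec (suc (suc n)) at₁
  x₁ = projR (fs fz)

  x₂ : ∀ {n} → Rec (suc (suc (suc n))) at₂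
  x₂ = projR (fs (fs fz))

  addR : Op2 _+_
  addR = op2 {f = _+_} (extensional (primrecR x₀ (sucR x₁)) correct)
    where
    correct : ∀ xs → primrec at₀ (suc ∘ at₁) xs ≡ at₀ xs + at₁ xs
    correct (zero  ∷ x ∷ []) = refl
    correct (suc y ∷ x ∷ []) = cong suc (correct (y ∷ x ∷ []))

  mulR : Op2 _*_
  mulR = op2 {f = _*_} (extensional (primrecR zeroR (addR x₂ x₁)) correct)
    where
    correct : ∀ xs → primrec (λ _ → 0) (λ ys → at₂ ys + at₁ ys) xs ≡ at₀ xs * at₁ xs
    correct (zero  ∷ x ∷ []) = refl
    correct (suc y ∷ x ∷ []) = cong (x +_) (correct (y ∷ x ∷ []))

  predR : Op1 pred
  predR = op1 {f = pred} (extensional (primrecR zeroR x₀) λ { (zero ∷ []) → refl ; (suc y ∷ []) → refl })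

  monusR : Op2 _∸_
  monusR rg rh = compR (extensional (primrecR x₀ (predR x₁)) correct) (consR rh (consR rg nilR))
    where
    correct : ∀ xs → primrec at₀ (pred ∘ at₁) xs ≡ at₁ xs ∸ at₀ xs
    correct (zero  ∷ x ∷ []) = refl
    correct (suc y ∷ x ∷ []) = trans (cong pred (correct (y ∷ x ∷ []))) (pred[m∸n]≡m∸[1+n] x y)

  pow2R : Op1 (2 ^_)
  pow2R = op1 {f = 2 ^_} (extensional (primrecR (constR 1) (mulR (constR 2) x₁)) correct)
    where
    correct : ∀ xs → primrec (λ _ → 1) (λ ys → 2 * at₁ ys) xs ≡ 2 ^ at₀ xs
    correct (zero  ∷ []) = refl
    correct (suc y ∷ []) = cong (2 *_) (correct (y ∷ []))

  positiveR : ∀ {n g} → Rec n g → RecPred n (λ xs → positive (g xs))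
  positiveR = op1 {f = bit ∘ positive} (extensional (primrecR zeroR (constR 1)) λ { (zero ∷ []) → refl ; (suc y ∷ []) → refl })

  ifR : ∀ {n B u v} → RecPred n B → Rec n u → Rec n v → Rec n (λ xs → if B xs then u xs else v xs)
  ifR {B = B} {u} {v} rb ru rv =
    extensional (addR (mulR rb ru) (mulR (monusR (constR 1) rb) rv)) correct
    where
    correct : ∀ xs → bit (B xs) * u xs + (1 ∸ bit (B xs)) * v xs ≡ (if B xs then u xs else v xs)
    correct xs with B xs
    ... | true  = trans (+-identityʳ (u xs + 0)) (+-identityʳ (u xs))
    ... | false = +-identityʳ (v xs)

  ifPredR : ∀ {n B C D} → RecPred n B → RecPred n C → RecPred n D →
            RecPred n (λ xs → if B xs then C xs else D xs)
  ifPredR {B = B} rb rc rd = extensional (ifR rb rc rd) λ xs → sym (if-float bit (B xs))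

  notR : ∀ {n B} → RecPred n B → RecPred n (λ xs → not (B xs))
  notR {B = B} rb = extensional (ifR rb (constR 0) (constR 1)) correct
    where
    correct : ∀ xs → (if B xs then 0 else 1) ≡ bit (not (B xs))
    correct xs with B xs
    ... | true  = refl
    ... | false = refl

  andR : ∀ {n B C} → RecPred n B → RecPred n C → RecPred n (λ xs → B xs ∧ C xs)
  andR {B = B} {C} rb rc = extensional (ifR rb rc (constR 0)) correct
    where
    correct : ∀ xs → (if B xs then bit (C xs) else 0) ≡ bit (B xs ∧ C xs)
    correct xs with B xs
    ... | true  = refl
    ... | false = refl

  ltR : ∀ {n g h} → Rec n g → Rec n h → RecPred n (λ xs → g xs <ᵇ h xs)
  ltR {g = g} {h} rg rh = extensional (positiveR (monusR rh rg)) λ xs → cong bit (positive-∸ (g xs) (h xs))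

  eqR : ∀ {n g h} → Rec n g → Rec n h → RecPred n (λ xs → g xs ≡ᵇ h xs)
  eqR {g = g} {h} rg rh =
    extensional (notR (positiveR (addR (monusR rg rh) (monusR rh rg)))) λ xs → cong bit (positive-distance (g xs) (h xs))

  sumR : ∀ {n F} → Rec (suc n) F → Rec (suc n) (λ ys → sumBelow (head ys) (λ i → F (i ∷ tail ys)))
  sumR {F = F} rF = extensional (primrecR zeroR (addR x₁ (compR rF dropSecondR))) correct
    where
    correct : ∀ ys → primrec (λ _ → 0) (λ zs → at₁ zs + F (dropSecond zs)) ys ≡ sumBelow (head ys) (λ i → F (i ∷ tail ys))
    correct (zero  ∷ xs) = refl
    correct (suc m ∷ xs) = cong (_+ F (m ∷ xs)) (correct (m ∷ xs))

  iterR : ∀ {F} → Op1 F → Op2 (iter F)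
  iterR {F} rF = op2 {f = iter F} (extensional (primrecR x₀ (rF x₁)) correct)
    where
    correct : ∀ xs → primrec at₀ (F ∘ at₁) xs ≡ iter F (at₀ xs) (at₁ xs)
    correct (zero  ∷ x ∷ []) = refl
    correct (suc n ∷ x ∷ []) = cong F (correct (n ∷ x ∷ []))

  pairR : Op2 pair
  pairR rg rh = mulR (pow2R rg) (addR (mulR (constR 2) rh) (constR 1))

  opaque
   unfolding unpair
   unpairR : ∀ {sel} → Op2 sel → Op1 (unpair sel)
   unpairR {sel} rsel = op1 {f = unpair sel}
     (extensional (compR (sumR row) (consR (sucR x₀) (consR x₀ nilR))) λ { (x ∷ []) → refl })
     where
     -- the term for b of row a of the double sum, on inputs (b ∷ a ∷ x ∷ [])
     term : Rec 3 (λ xs → if pair (at₁ xs) (at₀ xs) ≡ᵇ at₂ xs then sel (at₁ xs) (at₀ xs) else 0)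
     term = ifR (eqR (pairR x₁ x₀) x₂) (rsel x₁ x₀) (constR 0)
     -- row a of the double sum, on inputs (a ∷ x ∷ [])
     row : Rec 2 (λ xs → sumBelow (suc (at₁ xs)) λ b → if pair (at₀ xs) b ≡ᵇ at₁ xs then sel (at₀ xs) b else 0)
     row = extensional (compR (sumR term) (consR (sucR x₁) (consR x₀ (consR x₁ nilR)))) λ { (a ∷ x ∷ []) → refl }

  firstR : Op1 first
  firstR = unpairR (λ rg rh → rg)

  secondR : Op1 second
  secondR = unpairR (λ rg rh → rh)

OneOr : ℕ → ℕ → Set
OneOr n c = c ≡ 1 ⊎ c ≡ n

-- The children of a node of an s-branching tree, read through j ↦ min(j, s):
-- t j says whether min(j, s) is a child, so t is constant from s on.
Saturated : ℕ → (ℕ → Bool) → Set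
Saturated s t = ∀ j → s ≤ j → t j ≡ t s

-- Reading the children of a node of an s-branching tree
-- through min(j, s) makes j ∈ {0,…,k} a child iff t j; this gives 1 or s
-- children when s is not a child, and k+1-s or k when it is.  The missing
-- children are supplied as follows (t 0, t 1 decide between 1 and s, as s ≥ 2):
--   s a child, only it:   padding children j < s-1;
--   s not a child, s of them:  padding children s ≤ j < k.
pad : ℕ → ℕ → (ℕ → Bool) → ℕ → Bool
pad k s t j = if t s then not (t 0) ∧ not (t 1) ∧ (j <ᵇ pred s)
                     else t 0 ∧ t 1 ∧ not (j <ᵇ s) ∧ (j <ᵇ k)

module PaddingCases (s₂ d : ℕ) (t : ℕ → Bool) (saturated : Saturated (2 + s₂) t)
                    (branching : OneOr (2 + s₂) (count (3 + s₂) t)) where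
  s k : ℕ
  s = 2 + s₂
  k = s + d

  alive : ℕ → Bool
  alive j = t j ∨ pad k s t j

  below : ℕ
  below = count s t

  branching-without-s : t s ≡ false → OneOr s below
  branching-without-s ts =
    subst (OneOr s) (trans (count-last s t) (trans (cong (λ b → below + bit b) ts) (+-identityʳ below))) branching

  branching-with-s : t s ≡ true → OneOr s (below + 1)
  branching-with-s ts = subst (OneOr s) (trans (count-last s t) (cong (λ b → below + bit b) ts)) branching

  -- counting through min(j, s)
  count-t : count (suc k) t ≡ below + suc d * bit (t s)
  count-t = begin
    count (suc k) t                          ≡⟨ cong (λ n → count n t) (sym (+-suc s d)) ⟩
    count (s + suc d) t                      ≡⟨ count-split s (suc d) t ⟩
    below + count (suc d) (λ i → t (s + i))  ≡⟨ cong (below +_) (count-cong (suc d) λ i _ → saturated (s + i) (m≤m+n s i)) ⟩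
    below + count (suc d) (λ _ → t s)        ≡⟨ cong (below +_) (count-const (suc d) (t s)) ⟩
    below + suc d * bit (t s)                ∎
    where open ≡-Reasoning

  unpadded : (∀ j → pad k s t j ≡ false) → count (suc k) alive ≡ count (suc k) t
  unpadded no-pad = count-cong (suc k) λ j _ → trans (cong (t j ∨_) (no-pad j)) (∨-identityʳ (t j))

  -- s is not a child but 0 and 1 are: s children below s, padded up to k
  case-full : t s ≡ false → t 0 ≡ true → t 1 ≡ true → OneOr k (count (suc k) alive)
  case-full ts t0 t1 = inj₂ (trans (count-cong (suc k) λ j _ → alive≡<k j) (count-below (suc k) k (n≤1+n k)))
    where
    two≤below : 2 ≤ below
    two≤below rewrite t0 | t1 = s≤s (s≤s z≤n)
    below≡s : below ≡ s
    below≡s with branching-without-s ts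
    ... | inj₁ below≡1 = ⊥-elim (<-irrefl (sym below≡1) two≤below)
    ... | inj₂ below≡s = below≡s
    alive≡<k : ∀ j → alive j ≡ (j <ᵇ k)
    alive≡<k j with j <? s
    ... | yes j<s = trans (cong (_∨ pad k s t j) (count-full s t below≡s j j<s)) (sym (<ᵇ-true (≤-trans j<s (m≤m+n s d))))
    ... | no  j≮s rewrite saturated j (≮⇒≥ j≮s) | ts | t0 | t1 | <ᵇ-false (≮⇒≥ j≮s) = refl

  pad-off-low : t s ≡ false → t 0 ≡ false ⊎ t 1 ≡ false → ∀ j → pad k s t j ≡ false
  pad-off-low ts (inj₁ t0) j rewrite ts | t0 = refl
  pad-off-low ts (inj₂ t1) j rewrite ts | t1 = ∧-zeroʳ (t 0)

  pad-off-high : t s ≡ true → t 0 ≡ true ⊎ t 1 ≡ true → ∀ j → pad k s t j ≡ false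
  pad-off-high ts (inj₁ t0) j rewrite ts | t0 = refl
  pad-off-high ts (inj₂ t1) j rewrite ts | t1 = ∧-zeroʳ (not (t 0))

  -- s is not a child and 0 or 1 is not either: a single child, no padding
  case-single : t s ≡ false → t 0 ≡ false ⊎ t 1 ≡ false → OneOr k (count (suc k) alive)
  case-single ts t01 =
    inj₁ (trans (unpadded (pad-off-low ts t01)) (trans count-t (trans (cong (λ b → below + suc d * bit b) ts) below-count)))
    where
    not-full : ¬ below ≡ s
    not-full below≡s = either (λ t0 → true≢false (trans (sym (count-full s t below≡s 0 (s≤s z≤n))) t0))
                              (λ t1 → true≢false (trans (sym (count-full s t below≡s 1 (s≤s (s≤s z≤n)))) t1)) t01
    below-count : below + suc d * 0 ≡ 1
    below-count rewrite *-zeroʳ d | +-identityʳ below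
      with branching-without-s ts
    ... | inj₁ below≡1 = below≡1
    ... | inj₂ below≡s = ⊥-elim (not-full below≡s)

  -- s is the only child: k+1-s children from s on, padded by all j < s-1
  case-top : t s ≡ true → t 0 ≡ false → t 1 ≡ false → OneOr k (count (suc k) alive)
  case-top ts t0 t1 =
    inj₂ (trans (count-cong (suc k) λ j _ → alive≡≢ j) (count-except (suc k) (suc s₂) (≤-trans (m≤m+n s d) (n≤1+n k))))
    where
    below≤ : below ≤ s₂
    below≤ rewrite t0 | t1 = count≤ s₂ _
    below≡0 : below ≡ 0
    below≡0 with branching-with-s ts
    ... | inj₁ below+1≡1 = +-cancelʳ-≡ 1 below 0 below+1≡1
    ... | inj₂ below+1≡s = ⊥-elim (<-irrefl (+-cancelʳ-≡ 1 below (suc s₂) (trans below+1≡s (+-comm 1 (suc s₂)))) (s≤s below≤))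
    alive≡≢ : ∀ j → alive j ≡ not (j ≡ᵇ suc s₂)
    alive≡≢ j with j <? s
    ... | yes j<s rewrite count-empty s t below≡0 j j<s | ts | t0 | t1 = <ᵇ-≢ (≤-pred j<s)
    ... | no  j≮s rewrite saturated j (≮⇒≥ j≮s) | ts
                        | ≢⇒≡ᵇ-false j (suc s₂) (λ { refl → j≮s (n<1+n (suc s₂)) }) = refl

  -- s is a child and so is 0 or 1: s-1 children below s, k+1-s from s on
  case-rest : t s ≡ true → t 0 ≡ true ⊎ t 1 ≡ true → OneOr k (count (suc k) alive)
  case-rest ts t01 = inj₂ (trans (unpadded (pad-off-high ts t01)) (trans count-t total))
    where
    one≤below : 1 ≤ below
    one≤below = either (λ t0 → subst (λ b → 1 ≤ bit b + rest) (sym t0) (s≤s z≤n))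
                         (λ t1 → subst (λ b → 1 ≤ bit (t 0) + (bit b + rest₂)) (sym t1) (≤-trans (s≤s z≤n) (m≤n+m (suc rest₂) (bit (t 0))))) t01
      where
      rest rest₂ : ℕ
      rest  = count (suc s₂) (t ∘ suc)
      rest₂ = count s₂ (t ∘ suc ∘ suc)
    below≡ : below ≡ suc s₂
    below≡ with branching-with-s ts
    ... | inj₁ below+1≡1 = ⊥-elim (<-irrefl (sym (+-cancelʳ-≡ 1 below 0 below+1≡1)) one≤below)
    ... | inj₂ below+1≡s = +-cancelʳ-≡ 1 below (suc s₂) (trans below+1≡s (+-comm 1 (suc s₂)))
    total : below + suc d * bit (t s) ≡ k
    total rewrite ts | below≡ | *-identityʳ d = cong suc (+-suc s₂ d)

  padded-branching : OneOr k (count (suc k) alive)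
  padded-branching = by-cases (t s) (t 0) (t 1) refl refl refl
    where
    by-cases : ∀ bs b0 b1 → t s ≡ bs → t 0 ≡ b0 → t 1 ≡ b1 → OneOr k (count (suc k) alive)
    by-cases false true  true  ts t0 t1 = case-full ts t0 t1
    by-cases false false _     ts t0 t1 = case-single ts (inj₁ t0)
    by-cases false true  false ts t0 t1 = case-single ts (inj₂ t1)
    by-cases true  false false ts t0 t1 = case-top ts t0 t1
    by-cases true  true  _     ts t0 t1 = case-rest ts (inj₁ t0)
    by-cases true  false true  ts t0 t1 = case-rest ts (inj₂ t1)

padding : ∀ k s → 2 ≤ s → s ≤ k → (t : ℕ → Bool) → Saturated s t → OneOr s (count (suc s) t) →
          OneOr k (count (suc k) (λ j → t j ∨ pad k s t j))
padding k (suc (suc s₂)) (s≤s (s≤s z≤n)) s≤k t saturated branching with m≤n⇒∃[o]m+o≡n s≤k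
... | d , refl = PaddingCases.padded-branching s₂ d t saturated branching

succCount-count : ∀ {n} (T : List (Fin n) → Bool) σ (Q : ℕ → Bool) →
                  (∀ i → T (σ ++ [ i ]) ≡ Q (toℕ i)) → succCount T σ ≡ count n Q
succCount-count {n} T σ Q T≡Q =
  trans (cong sum (map-tabulate id (λ i → bit (T (σ ++ [ i ]))))) (sum-tabulate n (λ i → T (σ ++ [ i ])) Q T≡Q)
  where
  sum-tabulate : ∀ n (P : Fin n → Bool) (Q : ℕ → Bool) → (∀ i → P i ≡ Q (toℕ i)) →
                 sum (tabulate (bit ∘ P)) ≡ count n Q
  sum-tabulate zero    P Q P≡Q = refl
  sum-tabulate (suc n) P Q P≡Q = cong₂ _+_ (cong bit (P≡Q fz)) (sum-tabulate n (P ∘ fs) (Q ∘ suc) (P≡Q ∘ fs))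

clamp : ∀ s → ℕ → Fin (suc s)
clamp zero    j       = fz
clamp (suc s) zero    = fz
clamp (suc s) (suc j) = fs (clamp s j)

toℕ-clamp : ∀ s j → toℕ (clamp s j) ≡ (if j <ᵇ s then j else s)
toℕ-clamp zero    j       = refl
toℕ-clamp (suc s) zero    = refl
toℕ-clamp (suc s) (suc j) with j <ᵇ s | toℕ-clamp s j
... | true  | eq = cong suc eq
... | false | eq = cong suc eq

clamp-toℕ : ∀ s (i : Fin (suc s)) → clamp s (toℕ i) ≡ i
clamp-toℕ zero    fz     = refl
clamp-toℕ (suc s) fz     = refl
clamp-toℕ (suc s) (fs i) = cong fs (clamp-toℕ s i)

clamp-saturates : ∀ s j → s ≤ j → clamp s j ≡ clamp s s
clamp-saturates zero    j       _         = refl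
clamp-saturates (suc s) (suc j) (s≤s s≤j) = cong fs (clamp-saturates s j s≤j)

-- One step of the automaton below, from state m along the label j, when
-- t describes the children of the tracked T-node.
automaton : ℕ → ℕ → (ℕ → Bool) → ℕ → ℕ → ℕ
automaton k s t zero          j = 0
automaton k s t (suc zero)    j = if j <ᵇ k then 1 else 0
automaton k s t (suc (suc _)) j = if t j then 2 else if pad k s t j then 1 else 0

automaton-cong : ∀ k s {t t′} → (∀ j → t j ≡ t′ j) → ∀ m j → automaton k s t m j ≡ automaton k s t′ m j
automaton-cong k s t≡t′ zero          j = refl
automaton-cong k s t≡t′ (suc zero)    j = refl
automaton-cong k s t≡t′ (suc (suc _)) j rewrite t≡t′ j | t≡t′ s | t≡t′ 0 | t≡t′ 1 = refl

-- States: 0 = left the new tree, 1 = free (everything below a free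
-- node is the full k-branching tree on {0,…,k-1}), ≥ 2 = tracking T.
module Construction (k s : ℕ) (T : List (Fin (suc s)) → Bool) where

  step : (ℕ → Bool) → ℕ → ℕ → ℕ
  step = automaton k s

  children : List (Fin (suc s)) → ℕ → Bool
  children τ j = T (τ ++ [ clamp s j ])

  shadow : List (Fin (suc k)) → List (Fin (suc s))
  shadow = map (clamp s ∘ toℕ)

  run : ℕ → List (Fin (suc s)) → List (Fin (suc k)) → ℕ
  run m τ []      = m
  run m τ (y ∷ ρ) = run (step (children τ) m (toℕ y)) (τ ++ [ clamp s (toℕ y) ]) ρ

  state : List (Fin (suc k)) → ℕ
  state = run 2 []

  Tk : List (Fin (suc k)) → Bool
  Tk σ = positive (state σ)

  run-++ : ∀ m τ σ ρ → run m τ (σ ++ ρ) ≡ run (run m τ σ) (τ ++ shadow σ) ρ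
  run-++ m τ []      ρ = cong (λ τ′ → run m τ′ ρ) (sym (++-identityʳ τ))
  run-++ m τ (y ∷ σ) ρ = trans (run-++ _ (τ ++ [ c ]) σ ρ)
                              (cong (λ τ′ → run (run _ (τ ++ [ c ]) σ) τ′ ρ) (++-assoc τ [ c ] (shadow σ)))
    where
    c : Fin (suc s)
    c = clamp s (toℕ y)

  state-snoc : ∀ σ y → state (σ ++ [ y ]) ≡ step (children (shadow σ)) (state σ) (toℕ y)
  state-snoc σ y = run-++ 2 [] σ [ y ]

  run-dead : ∀ τ ρ → run 0 τ ρ ≡ 0
  run-dead τ []      = refl
  run-dead τ (y ∷ ρ) = run-dead _ ρ

  step-tracks : ∀ τ m j → 2 ≤ step (children τ) m j → children τ j ≡ true
  step-tracks τ (suc zero) j 2≤ with j <ᵇ k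
  step-tracks τ (suc zero) j (s≤s ()) | true
  step-tracks τ (suc (suc _)) j 2≤ with children τ j | pad k s (children τ) j
  ... | true  | _     = refl
  step-tracks τ (suc (suc _)) j (s≤s ()) | false | true

  step-follows : ∀ τ j → children τ j ≡ true → step (children τ) 2 j ≡ 2
  step-follows τ j child rewrite child = refl

  run-tracks : ∀ m τ ρ → (2 ≤ m → T τ ≡ true) → 2 ≤ run m τ ρ → T (τ ++ shadow ρ) ≡ true
  run-tracks m τ []      inv 2≤ = subst (λ τ′ → T τ′ ≡ true) (sym (++-identityʳ τ)) (inv 2≤)
  run-tracks m τ (y ∷ ρ) inv 2≤ =
    subst (λ τ′ → T τ′ ≡ true) (++-assoc τ [ clamp s (toℕ y) ] (shadow ρ))
          (run-tracks _ (τ ++ [ clamp s (toℕ y) ]) ρ (step-tracks τ m (toℕ y)) 2≤)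

  state-tracks : T [] ≡ true → ∀ σ → 2 ≤ state σ → T (shadow σ) ≡ true
  state-tracks root σ = run-tracks 2 [] σ (λ _ → root)

  -- Tk is closed under prefixes: once the automaton has left, it stays out.
  Tk-tree : IsTree Tk
  Tk-tree σ .(σ ++ ρ) (ρ , refl) Tk-σρ with state σ in eq
  ... | suc _ = refl
  ... | zero  = sym (trans (sym Tk-σρ) (cong positive stays-out))
    where
    stays-out : state (σ ++ ρ) ≡ 0
    stays-out = trans (run-++ 2 [] σ ρ) (trans (cong (λ m → run m (shadow σ) ρ) eq) (run-dead (shadow σ) ρ))

  module _ (f : ℕ → Fin (suc k)) (shadow-path : IsPath T (clamp s ∘ toℕ ∘ f)) where
    shadow-restrict : ∀ m → shadow (restrict f m) ≡ restrict (clamp s ∘ toℕ ∘ f) m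
    shadow-restrict zero    = refl
    shadow-restrict (suc m) = trans (map-++ _ (restrict f m) [ f m ]) (cong (_++ [ clamp s (toℕ (f m)) ]) (shadow-restrict m))

    tracking-along : ∀ m → state (restrict f m) ≡ 2
    tracking-along zero    = refl
    tracking-along (suc m) = begin
      state (restrict f m ++ [ f m ])           ≡⟨ state-snoc (restrict f m) (f m) ⟩
      step (children τ) (state (restrict f m)) j ≡⟨ cong (λ n → step (children τ) n j) (tracking-along m) ⟩
      step (children τ) 2 j                      ≡⟨ step-follows τ j child ⟩
      2                                          ∎
      where
      open ≡-Reasoning
      τ : List (Fin (suc s))
      τ = shadow (restrict f m)
      j : ℕ
      j = toℕ (f m)
      child : children τ j ≡ true
      child = subst (λ τ′ → T (τ′ ++ [ clamp s j ]) ≡ true) (sym (shadow-restrict m)) (shadow-path (suc m))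

    Tk-path : IsPath Tk f
    Tk-path m = cong positive (tracking-along m)

  Tk-branching : 2 ≤ s → s ≤ k → IsBranching s T → T [] ≡ true → IsBranching k Tk
  Tk-branching 2≤s s≤k T-branching root σ Tk-σ =
    subst (OneOr k) (sym (succCount-count Tk σ (λ j → positive (step t (state σ) j)) child-state))
          (by-state (state σ) refl)
    where
    τ : List (Fin (suc s))
    τ = shadow σ
    t : ℕ → Bool
    t = children τ
    child-state : ∀ y → Tk (σ ++ [ y ]) ≡ positive (step t (state σ) (toℕ y))
    child-state y = cong positive (state-snoc σ y)
    t-saturated : Saturated s t
    t-saturated j s≤j = cong (λ c → T (τ ++ [ c ])) (clamp-saturates s j s≤j)
    t-branching : T τ ≡ true → OneOr s (count (suc s) t)
    t-branching T-τ = subst (OneOr s) (succCount-count T τ t λ i → cong (λ c → T (τ ++ [ c ])) (sym (clamp-toℕ s i)))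
                            (T-branching τ T-τ)
    by-state : ∀ m → state σ ≡ m → OneOr k (count (suc k) (λ j → positive (step t m j)))
    by-state zero          eq with trans (sym Tk-σ) (cong positive eq)
    ... | ()
    by-state (suc zero)    eq = inj₂ (trans (count-cong (suc k) λ j _ → free j) (count-below (suc k) k (n≤1+n k)))
      where
      free : ∀ j → positive (if j <ᵇ k then 1 else 0) ≡ (j <ᵇ k)
      free j with j <ᵇ k
      ... | true  = refl
      ... | false = refl
    by-state (suc (suc m)) eq = subst (OneOr k) (sym (count-cong (suc k) λ j _ → tracking j))
                                      (padding k s 2≤s s≤k t t-saturated (t-branching T-τ))
      where
      T-τ : T τ ≡ true
      T-τ = state-tracks root σ (subst (2 ≤_) (sym eq) (s≤s (s≤s z≤n)))
      tracking : ∀ j → positive (step t (suc (suc m)) j) ≡ (t j ∨ pad k s t j)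
      tracking j with t j | pad k s t j
      ... | true  | _     = refl
      ... | false | true  = refl
      ... | false | false = refl

-- Configurations of the decoding automaton, coded as numbers:
-- ⟨automaton state m, code c and offset o of the tracked T-node, code r of the unread input⟩.
mode node off input : ℕ → ℕ
mode  = first
node  = first ∘ second
off   = first ∘ second ∘ second
input = second ∘ second ∘ second

-- (Opaque, to keep the arithmetic of `pair` out of unification problems.)
opaque
  config : ℕ → ℕ → ℕ → ℕ → ℕ
  config m c o r = pair m (pair c (pair o r))

  config-fields : ∀ m c o r → (mode (config m c o r) ≡ m) × (node (config m c o r) ≡ c) ×
                              (off (config m c o r) ≡ o) × (input (config m c o r) ≡ r)
  config-fields m c o r rewrite second-pair m (pair c (pair o r)) | second-pair c (pair o r) =
    first-pair m (pair c (pair o r)) , first-pair c (pair o r) , first-pair o r , second-pair o r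

-- The decoding automaton for the tree  Construction.Tk k s T, given a
-- function χ deciding T on codes: it reads the code of σ letter by letter
-- and runs `automaton`, querying χ for the children of the tracked node.
module Decoder (k s : ℕ) (χ : ℕ → ℕ) where
  cap : ℕ → ℕ
  cap j = if j <ᵇ s then j else s

  -- is min(j, s) a child of the T-node with code c and offset o?
  query : ℕ → ℕ → ℕ → Bool
  query c o j = positive (χ (c + 2 ^ (o + cap j)))

  next : ℕ → ℕ → ℕ → ℕ → ℕ → ℕ
  next m c o y r = config (automaton k s (query c o) m y) (c + 2 ^ (o + cap y)) (suc (o + cap y)) r

  advanceWith : ℕ → ℕ → ℕ → ℕ → ℕ
  advanceWith m c o r = if positive r then next m c o (first r) (second r) else config m c o r

  advance : ℕ → ℕ
  advance st = advanceWith (mode st) (node st) (off st) (input st)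

  -- run from ⟨2, code and offset of the root, x⟩ for x steps (enough by length≤encode)
  decide : ℕ → ℕ
  decide x = bit (positive (mode (iter advance x (config 2 0 0 x))))

  advance-config : ∀ m c o r → advance (config m c o r) ≡ advanceWith m c o r
  advance-config m c o r with config-fields m c o r
  ... | m≡ , c≡ , o≡ , r≡ rewrite m≡ | c≡ | o≡ | r≡ = refl

  advance-letter : ∀ m c o a r → advance (config m c o (pair a r)) ≡ next m c o a r
  advance-letter m c o a r = begin
    advance (config m c o (pair a r))   ≡⟨ advance-config m c o (pair a r) ⟩
    advanceWith m c o (pair a r)        ≡⟨ cong (λ b → if b then next m c o (first (pair a r)) (second (pair a r)) else config m c o (pair a r))
                                                (pair-positive a r) ⟩
    next m c o (first (pair a r)) (second (pair a r))  ≡⟨ cong₂ (next m c o) (first-pair a r) (second-pair a r) ⟩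
    next m c o a r                      ∎
    where open ≡-Reasoning

  advance-done : ∀ m c o → advance (config m c o 0) ≡ config m c o 0
  advance-done m c o = advance-config m c o 0

  module Simulation (T : List (Fin (suc s)) → Bool) (χ-decides : ∀ τ → χ (encode τ) ≡ bit (T τ)) where
    open Construction k s T

    query-children : ∀ τ j → query (encode τ) (offset τ) j ≡ children τ j
    query-children τ j = begin
      positive (χ (encode τ + 2 ^ (offset τ + cap j)))
        ≡⟨ cong (λ n → positive (χ (encode τ + 2 ^ (offset τ + n)))) (sym (toℕ-clamp s j)) ⟩
      positive (χ (encode τ + 2 ^ (offset τ + toℕ (clamp s j))))
        ≡⟨ cong (positive ∘ χ) (sym (encode-snoc τ (clamp s j))) ⟩
      positive (χ (encode (τ ++ [ clamp s j ])))
        ≡⟨ cong positive (χ-decides (τ ++ [ clamp s j ])) ⟩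
      positive (bit (children τ j))
        ≡⟨ positive-bit (children τ j) ⟩
      children τ j ∎
      where open ≡-Reasoning

    advance-read : ∀ m (τ : List (Fin (suc s))) (y : Fin (suc k)) ρ →
      advance (config m (encode τ) (offset τ) (encode (y ∷ ρ)))
        ≡ config (step (children τ) m (toℕ y)) (encode (τ ++ [ clamp s (toℕ y) ])) (offset (τ ++ [ clamp s (toℕ y) ])) (encode ρ)
    advance-read m τ y ρ = trans (advance-letter m (encode τ) (offset τ) (toℕ y) (encode ρ)) (config-cong state≡ code≡ offset≡)
      where
      config-cong : ∀ {a a′ b b′ c c′} → a ≡ a′ → b ≡ b′ → c ≡ c′ → config a b c (encode ρ) ≡ config a′ b′ c′ (encode ρ)
      config-cong refl refl refl = refl
      cap≡ : cap (toℕ y) ≡ toℕ (clamp s (toℕ y))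
      cap≡ = sym (toℕ-clamp s (toℕ y))
      state≡ : automaton k s (query (encode τ) (offset τ)) m (toℕ y) ≡ step (children τ) m (toℕ y)
      state≡ = automaton-cong k s (query-children τ) m (toℕ y)
      code≡ : encode τ + 2 ^ (offset τ + cap (toℕ y)) ≡ encode (τ ++ [ clamp s (toℕ y) ])
      code≡ = trans (cong (λ n → encode τ + 2 ^ (offset τ + n)) cap≡) (sym (encode-snoc τ (clamp s (toℕ y))))
      offset≡ : suc (offset τ + cap (toℕ y)) ≡ offset (τ ++ [ clamp s (toℕ y) ])
      offset≡ = trans (cong (λ n → suc (offset τ + n)) cap≡) (sym (offset-snoc τ (clamp s (toℕ y))))

    simulate : ∀ n m (τ : List (Fin (suc s))) (ρ : List (Fin (suc k))) → length ρ ≤ n → mode (iter advance n (config m (encode τ) (offset τ) (encode ρ))) ≡ run m τ ρ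
    simulate n m τ [] _ =
      trans (cong mode (iter-fixed advance n (config m (encode τ) (offset τ) 0) (advance-done m (encode τ) (offset τ))))
          (proj₁ (config-fields m (encode τ) (offset τ) 0))
    simulate (suc n) m τ (y ∷ ρ) (s≤s |ρ|≤n) =
      trans (cong mode (trans (iter-suc advance n (config m (encode τ) (offset τ) (encode (y ∷ ρ))))
                               (cong (iter advance n) (advance-read m τ y ρ))))
            (simulate n (step (children τ) m (toℕ y)) (τ ++ [ clamp s (toℕ y) ]) ρ |ρ|≤n)

    decide-correct : ∀ σ → decide (encode σ) ≡ bit (Tk σ)
    decide-correct σ = cong (bit ∘ positive) (simulate (encode σ) 2 [] σ (length≤encode σ))

  module Computability (O : ℕ → ℕ) (χR : Recursive.Op1 O χ) where
    open Recursive O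

    opaque
      unfolding config
      configR : ∀ {n m c o r} → Rec n m → Rec n c → Rec n o → Rec n r → Rec n (λ xs → config (m xs) (c xs) (o xs) (r xs))
      configR rm rc ro rr = pairR rm (pairR rc (pairR ro rr))

    automatonR : ∀ {n} {t : Vec ℕ n → ℕ → Bool} {m j : Vec ℕ n → ℕ} → (∀ {J} → Rec n J → RecPred n (λ xs → t xs (J xs))) →
                 Rec n m → Rec n j → Rec n (λ xs → automaton k s (t xs) (m xs) (j xs))
    automatonR {n} {t} {m} {j} tR mR jR =
      extensional (ifR (positiveR mR) (ifR (positiveR (predR mR)) tracking free) (constR 0)) by-state
      where
      padR : RecPred n (λ xs → pad k s (t xs) (j xs))
      padR = ifPredR (tR (constR s))
                 (andR (notR (tR (constR 0))) (andR (notR (tR (constR 1))) (ltR jR (constR (pred s)))))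
                 (andR (tR (constR 0)) (andR (tR (constR 1)) (andR (notR (ltR jR (constR s))) (ltR jR (constR k)))))
      tracking : Rec n (λ xs → if t xs (j xs) then 2 else if pad k s (t xs) (j xs) then 1 else 0)
      tracking = ifR (tR jR) (constR 2) (ifR padR (constR 1) (constR 0))
      free : Rec n (λ xs → if j xs <ᵇ k then 1 else 0)
      free = ifR (ltR jR (constR k)) (constR 1) (constR 0)
      by-state : ∀ xs → (if positive (m xs) then (if positive (pred (m xs))
                           then (if t xs (j xs) then 2 else if pad k s (t xs) (j xs) then 1 else 0)
                           else (if j xs <ᵇ k then 1 else 0)) else 0)
                        ≡ automaton k s (t xs) (m xs) (j xs)
      by-state xs with m xs
      ... | zero        = refl
      ... | suc zero    = refl
      ... | suc (suc _) = refl

    capR : Op1 cap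
    capR rj = ifR (ltR rj (constR s)) rj (constR s)

    queryR : ∀ {n c o j} → Rec n c → Rec n o → Rec n j → RecPred n (λ xs → query (c xs) (o xs) (j xs))
    queryR rc ro rj = positiveR (χR (addR rc (pow2R (addR ro (capR rj)))))

    advanceR : Op1 advance
    advanceR {n} {st} rst = ifR (positiveR r) (configR (automatonR (queryR c o) m y) (addR c (pow2R (addR o (capR y))))
                                                (sucR (addR o (capR y))) (secondR r))
                                     (configR m c o r)
      where
      m : Rec n (λ xs → mode (st xs))
      m = firstR rst
      c : Rec n (λ xs → node (st xs))
      c = firstR (secondR rst)
      o : Rec n (λ xs → off (st xs))
      o = firstR (secondR (secondR rst))
      r : Rec n (λ xs → input (st xs))
      r = secondR (secondR (secondR rst))
      y : Rec n (λ xs → first (input (st xs)))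
      y = firstR r

    decideR : Op1 decide
    decideR rx = positiveR (firstR (iterR advanceR rx (configR (constR 2) (constR 0) (constR 0) rx)))

tree-computable : ∀ k s (T : List (Fin (suc s)) → Bool) → ComputableTree T → ComputableTree (Construction.Tk k s T)
tree-computable k s T (χ , χ-computable , χ-decides) =
  decide , toComputes decideR , Simulation.decide-correct T χ-decides
  where
  open Decoder k s χ
  open Computability (λ _ → 0) (Recursive.fromComputes (λ _ → 0) χ-computable)
  open Recursive (λ _ → 0) using (toComputes)

clamp-computable : ∀ s (g f : ℕ → ℕ) → ComputesFrom g f → ComputesFrom g (toℕ ∘ clamp s ∘ f)
clamp-computable s g f f-computable = toComputes clampR
  where
  open Recursive g
  fR : Op1 f
  fR = fromComputes f-computable
  clampR : Op1 (toℕ ∘ clamp s ∘ f)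
  clampR {g = x} rx = extensional (ifR (ltR (fR rx) (constR s)) (fR rx) (constR s)) (λ xs → sym (toℕ-clamp s (f (x xs))))

lemma2p5 : (k s : ℕ) → 2 ≤ s → s ≤ k → (g : ℕ → ℕ) →
    SurvivingDegree k g → SurvivingDegree s g
lemma2p5 k s 2≤s s≤k g (f , f-computable , f-surviving) =
  h , clamp-computable s g (toℕ ∘ f) f-computable , h-surviving
  where
  h : ℕ → Fin (suc s)
  h = clamp s ∘ toℕ ∘ f
  h-surviving : Surviving s h
  h-surviving T _ T-branching T-computable h-path =
    f-surviving Tk Tk-tree (Tk-branching 2≤s s≤k T-branching (h-path 0)) (tree-computable k s T T-computable) (Tk-path f h-path)
    where open Construction k s T
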